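{- Let $m,n\in\mathbb{N}$ and let $D\subseteq S_{0}$ be a piecewise syndetic subset of the semigroup $(S_{0},\cdot)$. Then there exists $w\in S_{n}$ with $w\in\bigcap_{\vec{a}\in\mathbb{A}_{m}^{n}}h_{\vec{a}}^{ -1}[D]$, that is, $w(\vec{a})\in D$ for every $\vec{a}\in\mathbb{A}_{m}^{n}$.
   Context: Let $\mathbb{A}_{1}\subseteq\mathbb{A}_{2}\subseteq\mathbb{A}_{3}\subseteq\cdots$ be an increasing sequence of finite nonempty alphabets and $\mathbb{A}=\bigcup_{i=1}^{\infty}\mathbb{A}_{i}$. $S_{0}$ is the set of all nonempty finite words over $\mathbb{A}$, a semigroup under concatenation. For $n\in\mathbb{N}$ let $v_{1},\dots,v_{n}$ be distinct variables not in $\mathbb{A}$; $S_{n}$ is the set of words over $\mathbb{A}\cup\{v_{1},\dots,v_{n}\}$ in which each $v_{i}$ occurs at least once. $S_{n}\cup S_{0}$ is a semigroup under concatenation. For $w\in S_{n}$ and $\vec{a}=(a_{1},\dots,a_{n})\in\mathbb{A}^{n}$, $w(\vec{a})$ is the word obtained by replacing each occurrence of $v_{i}$ by $a_{i}$; $h_{\vec{a}}:S_{n}\cup S_{0}\to S_{0}$ is the homomorphism with $h_{\vec{a}}(w)=w(\vec{a})$ for $w\in S_{n}$ and $h_{\vec{a}}$ the identity on $S_{0}$. A subset $B$ of a semigroup $S$ is piecewise syndetic if there is a finite $G\subseteq S$ such that for every finite $F\subseteq S$ there is $x\in S$ with $Fx\subseteq\bigcup_{t\in G}t^{ -1}B$,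 where $t^{ -1}B=\{y\in S:ty\in B\}$. -}

module Defs where

open import Data.Nat using (ℕ; suc)
open import Data.Fin using (Fin)
open import Data.Sum using (_⊎_; inj₁; inj₂; [_,_])
open import Data.Product using (Σ; ∃; _×_)
open import Data.List using (List; [])
open import Data.List.NonEmpty using (List⁺; _⁺++⁺_; toList) renaming (map to map⁺)
open import Data.List.Membership.Propositional using (_∈_)
open import Relation.Binary.PropositionalEquality using (_≢_)
open import Function using (id)

-- An increasing sequence of finite nonempty alphabets whose union is the
-- letter type.  Index convention: layer k is the paper's 𝔸_{k+1}.
record Alphabets : Set₁ where
  field
    Letter     : Set
    layer      : ℕ → List Letter
    nonempty   : ∀ k → layer k ≢ []
    increasing : ∀ k {x} → x ∈ layer k → x ∈ layer (suc k)
    covers     : ∀ (x : Letter) → ∃ λ k → x ∈ layer k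

module _ (𝔸 : Alphabets) where
  open Alphabets 𝔸

  -- S₀ : nonempty finite words over the letters; product = concatenation
  S₀ : Set
  S₀ = List⁺ Letter

  -- piecewise syndetic subsets of (S₀ , concatenation)
  -- t⁻¹B = { y | t y ∈ B };  F x ⊆ ⋃_{t ∈ G} t⁻¹ B
  PiecewiseSyndetic : (S₀ → Set) → Set
  PiecewiseSyndetic B =
    Σ (List S₀) λ G → ∀ (F : List S₀) → Σ S₀ λ x →
      ∀ {y} → y ∈ F → Σ S₀ λ t → (t ∈ G) × B (t ⁺++⁺ (y ⁺++⁺ x))

  -- words over letters and variables v₀ … v_{n-1}
  Word : ℕ → Set
  Word n = List⁺ (Letter ⊎ Fin n)

  InS : ∀ n → Word n → Set
  InS n w = ∀ (i : Fin n) → inj₂ i ∈ toList w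

  subst : ∀ {n} → Word n → (Fin n → Letter) → S₀
  subst w a = map⁺ [ id , a ] w

-- Piecewise syndeticity of D gives a finite G and, for the finitely many words y
-- spelling N-tuples of elements of 𝔸ₘⁿ (each element as a block of n letters),
-- an x and some t ∈ G with t y x ∈ D.  Read as a colouring of (𝔸ₘⁿ)ᴺ by G, the
-- Hales–Jewett theorem yields a combinatorial line λ on which t is constant.
-- Spelling the variable of λ as the block v₁ ⋯ vₙ gives w ∈ Sₙ with
-- w(a⃗) = t λ(a⃗) x ∈ D for every a⃗.  Hales–Jewett is proved by colour focusing.
module Submission where

open import Defs
open import Data.Nat using (ℕ; zero; suc; _+_; _^_)
open import Data.Nat.Properties using (n<1+n)
open import Data.Fin using (Fin; zero; suc; _≟_; funToFin; finToFun)
open import Data.Fin.Properties using (finToFun-funToFin; pigeonhole; any?; <⇒≢)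
open import Data.Vec as Vec using (Vec; []; _∷_; _++_; tabulate)
open import Data.Vec.Properties using (map-++; map-∘; map-id; map-cong; tabulate-cong; tabulate∘lookup; toList-map)
open import Data.Vec.Membership.Propositional using () renaming (_∈_ to _∈ᵥ_)
open import Data.Vec.Relation.Unary.Any as VecAny using ()
open import Data.Vec.Membership.Propositional.Properties using (∈-++⁺ˡ; ∈-++⁺ʳ; ∈-toList⁺)
  renaming (∈-map⁺ to ∈ᵥ-map⁺)
open import Data.Maybe as Maybe using (Maybe; just; nothing; fromMaybe)
open import Data.List as List using (List; length; allFin; concatMap)
open import Data.List.Properties using (map-concatMap; concatMap-cong; concatMap-map; map-tabulate)
  renaming (tabulate-cong to List-tabulate-cong)
open import Data.List.NonEmpty as List⁺ using (List⁺; _∷_; _⁺++⁺_; toList)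
open import Data.List.NonEmpty.Properties using (map-⁺++⁺)
  renaming (map-∘ to List⁺-map-∘; map-id to List⁺-map-id)
open import Data.List.Relation.Unary.Any as Any using (here; there)
open import Data.List.Relation.Unary.Any.Properties using (lookup-index)
open import Data.List.Membership.Propositional using (_∈_)
open import Data.List.Membership.Propositional.Properties
  using (∈-map⁺; ∈-concat⁺′; ∈-tabulate⁺; ∈-allFin) renaming (∈-++⁺ˡ to ∈ₗ-++⁺ˡ; ∈-++⁺ʳ to ∈ₗ-++⁺ʳ)
open import Data.Product using (Σ; ∃; _×_; _,_; proj₁; proj₂)
open import Data.Sum using (_⊎_; inj₁; inj₂; [_,_]; [_,_]′)
open import Data.Empty using (⊥-elim)
open import Function using (_∘_; id)
open import Relation.Nullary using (¬_; yes; no; contradiction)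
open import Relation.Binary.PropositionalEquality as ≡
  using (_≡_; _≢_; refl; sym; trans; cong; cong₂; module ≡-Reasoning)

VarWord : ℕ → ℕ → Set
VarWord k N = Vec (Maybe (Fin k)) N

_[_] : ∀ {k N} → VarWord k N → Fin k → Vec (Fin k) N
w [ x ] = Vec.map (fromMaybe x) w

Monochromatic : ∀ {k N} {C : Set} → (Vec (Fin k) N → C) → VarWord k N → Set
Monochromatic c w = ∀ x y → c (w [ x ]) ≡ c (w [ y ])

MonochromaticLine : ∀ {k N} {C : Set} → (Vec (Fin k) N → C) → Set
MonochromaticLine {k} {N} c = Σ (VarWord k N) λ w → nothing ∈ᵥ w × Monochromatic c w

HalesJewett : ℕ → ℕ → Set
HalesJewett k r = Σ ℕ λ N → (c : Vec (Fin k) N → Fin r) → MonochromaticLine c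

[]-++ : ∀ {k M N} (u : VarWord k M) (v : VarWord k N) x → (u ++ v) [ x ] ≡ u [ x ] ++ v [ x ]
[]-++ u v x = map-++ (fromMaybe x) u v

[]-constant : ∀ {k N} (u : Vec (Fin k) N) x → Vec.map just u [ x ] ≡ u
[]-constant u x = trans (sym (map-∘ (fromMaybe x) just u)) (map-id u)

liftVarWord : ∀ {k N} → VarWord k N → VarWord (suc k) N
liftVarWord = Vec.map (Maybe.map suc)

liftVarWord-[] : ∀ {k N} (w : VarWord k N) x → liftVarWord w [ suc x ] ≡ Vec.map suc (w [ x ])
liftVarWord-[] w x = begin
  Vec.map (fromMaybe (suc x)) (Vec.map (Maybe.map suc) w) ≡⟨ map-∘ _ _ w ⟨
  Vec.map (fromMaybe (suc x) ∘ Maybe.map suc) w            ≡⟨ map-cong commute w ⟩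
  Vec.map (suc ∘ fromMaybe x) w                            ≡⟨ map-∘ _ _ w ⟩
  Vec.map suc (w [ x ])                                    ∎
  where
  open ≡-Reasoning
  commute : ∀ e → fromMaybe (suc x) (Maybe.map suc e) ≡ suc (fromMaybe x e)
  commute (just y) = refl
  commute nothing = refl

monochromaticLine-prefix : ∀ {k M N r} (p : Vec (Fin k) M) (c : Vec (Fin k) (M + N) → Fin r) →
                           MonochromaticLine (c ∘ (p ++_)) → MonochromaticLine c
monochromaticLine-prefix p c (w , var , mono) =
  Vec.map just p ++ w , ∈-++⁺ʳ (Vec.map just p) var , λ x y → begin
    c ((Vec.map just p ++ w) [ x ]) ≡⟨ cong c (prefix x) ⟩
    c (p ++ w [ x ])                ≡⟨ mono x y ⟩
    c (p ++ w [ y ])                ≡⟨ cong c (prefix y) ⟨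
    c ((Vec.map just p ++ w) [ y ]) ∎
  where
  open ≡-Reasoning
  prefix : ∀ x → (Vec.map just p ++ w) [ x ] ≡ p ++ w [ x ]
  prefix x = trans ([]-++ (Vec.map just p) w x) (cong (_++ w [ x ]) ([]-constant p x))

vecToCode : ∀ {k N} → Vec (Fin k) N → Fin (k ^ N)
vecToCode = funToFin ∘ Vec.lookup

vecFromCode : ∀ {k N} → Fin (k ^ N) → Vec (Fin k) N
vecFromCode = tabulate ∘ finToFun

vecFromCode-vecToCode : ∀ {k N} (v : Vec (Fin k) N) → vecFromCode (vecToCode v) ≡ v
vecFromCode-vecToCode v = trans (tabulate-cong (finToFun-funToFin (Vec.lookup v))) (tabulate∘lookup v)

allVecs : ∀ k N → List (Vec (Fin k) N)
allVecs k N = List.map vecFromCode (allFin (k ^ N))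

∈-allVecs : ∀ {k N} (v : Vec (Fin k) N) → v ∈ allVecs k N
∈-allVecs v = ≡.subst (_∈ _) (vecFromCode-vecToCode v) (∈-map⁺ vecFromCode (∈-allFin (vecToCode v)))

colouringCode : ∀ {k N r} → (Vec (Fin k) N → Fin r) → Fin (r ^ (k ^ N))
colouringCode c = funToFin (c ∘ vecFromCode)

colouringCode-injective : ∀ {k N r} (c c′ : Vec (Fin k) N → Fin r) →
                          colouringCode c ≡ colouringCode c′ → ∀ v → c v ≡ c′ v
colouringCode-injective c c′ eq v = begin
  c v                                       ≡⟨ cong c (vecFromCode-vecToCode v) ⟨
  c (vecFromCode (vecToCode v))             ≡⟨ finToFun-funToFin _ (vecToCode v) ⟨
  finToFun (colouringCode c) (vecToCode v)  ≡⟨ cong (λ f → finToFun f (vecToCode v)) eq ⟩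
  finToFun (colouringCode c′) (vecToCode v) ≡⟨ finToFun-funToFin _ (vecToCode v) ⟩
  c′ (vecFromCode (vecToCode v))            ≡⟨ cong c′ (vecFromCode-vecToCode v) ⟩
  c′ v                                      ∎
  where open ≡-Reasoning

-- Hales–Jewett for the colouring a ↦ c a, coded as a single finite colour.
uniformLine : ∀ {k A M N r} →
              ((c : Vec (Fin k) M → Fin (r ^ (A ^ N))) → MonochromaticLine c) →
              (c : Vec (Fin k) M → Vec (Fin A) N → Fin r) →
              Σ (VarWord k M) λ w → nothing ∈ᵥ w × (∀ b → Monochromatic (λ a → c a b) w)
uniformLine hj c with hj (colouringCode ∘ c)
... | w , var , mono = w , var , λ b x y → colouringCode-injective (c _) (c _) (mono x y) b

module ColourFocusing {k r : ℕ} (hj : ∀ r′ → HalesJewett k r′) (x₀ : Fin k) where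

  -- In Fin (suc k) the letter zero is the new one; the old letters are suc x.
  record Focused {N} (c : Vec (Fin (suc k)) N → Fin r) (s : ℕ) : Set where
    field
      line             : Fin s → VarWord (suc k) N
      focus            : Vec (Fin (suc k)) N
      colour           : Fin s → Fin r
      colour-injective : ∀ i j → colour i ≡ colour j → i ≡ j
      line-hasVar      : ∀ i → nothing ∈ᵥ line i
      line-focused     : ∀ i → line i [ zero ] ≡ focus
      line-coloured    : ∀ i x → c (line i [ suc x ]) ≡ colour i

  open Focused

  focused-monochromatic : ∀ {N s} {c : Vec (Fin (suc k)) N → Fin r} (F : Focused c s) i →
                          c (focus F) ≡ colour F i → MonochromaticLine c
  focused-monochromatic {c = c} F i eq =
    line F i , line-hasVar F i , λ x y → trans (coloured x) (sym (coloured y))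
    where
    coloured : ∀ x → c (line F i [ x ]) ≡ colour F i
    coloured zero = trans (cong c (line-focused F i)) eq
    coloured (suc x) = line-coloured F i x

  ¬focused : ∀ {N} {c : Vec (Fin (suc k)) N → Fin r} → ¬ Focused c (suc r)
  ¬focused F with pigeonhole (n<1+n r) (colour F)
  ... | i , j , i<j , eq = <⇒≢ i<j (colour-injective F i j eq)

  -- Prefixing u to each focused line and to the constant word at the focus
  -- adds a line of the new colour c′ focus.
  extendFocused : ∀ {M N s} (c : Vec (Fin (suc k)) (M + N) → Fin r) (u : VarWord (suc k) M) →
                  nothing ∈ᵥ u → (c′ : Vec (Fin (suc k)) N → Fin r) →
                  (∀ x b → c (u [ suc x ] ++ b) ≡ c′ b) →
                  (F : Focused c′ s) → ¬ (∃ λ i → c′ (focus F) ≡ colour F i) →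
                  Focused c (suc s)
  extendFocused {s = s} c u var c′ u-coloured F new = record
    { line = line′ ; focus = u [ zero ] ++ focus F ; colour = colour′
    ; colour-injective = injective ; line-hasVar = hasVar
    ; line-focused = focused ; line-coloured = coloured }
    where
    line′ : Fin (suc s) → VarWord (suc k) _
    line′ zero = u ++ Vec.map just (focus F)
    line′ (suc i) = u ++ line F i
    colour′ : Fin (suc s) → Fin r
    colour′ zero = c′ (focus F)
    colour′ (suc i) = colour F i
    injective : ∀ i j → colour′ i ≡ colour′ j → i ≡ j
    injective zero zero _ = refl
    injective zero (suc j) eq = contradiction (j , eq) new
    injective (suc i) zero eq = contradiction (i , sym eq) new
    injective (suc i) (suc j) eq = cong suc (colour-injective F i j eq)
    hasVar : ∀ i → nothing ∈ᵥ line′ i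
    hasVar zero = ∈-++⁺ˡ var
    hasVar (suc i) = ∈-++⁺ˡ var
    focused : ∀ i → line′ i [ zero ] ≡ u [ zero ] ++ focus F
    focused zero = trans ([]-++ u _ zero) (cong (u [ zero ] ++_) ([]-constant (focus F) zero))
    focused (suc i) = trans ([]-++ u _ zero) (cong (u [ zero ] ++_) (line-focused F i))
    coloured : ∀ i x → c (line′ i [ suc x ]) ≡ colour′ i
    coloured zero x = trans (cong c (trans ([]-++ u _ (suc x))
      (cong (u [ suc x ] ++_) ([]-constant (focus F) (suc x))))) (u-coloured x (focus F))
    coloured (suc i) x = trans (cong c ([]-++ u _ (suc x)))
      (trans (u-coloured x (line F i [ suc x ])) (line-coloured F i x))

  focusing : ∀ s → Σ ℕ λ N → (c : Vec (Fin (suc k)) N → Fin r) → MonochromaticLine c ⊎ Focused c s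
  focusing zero = 0 , λ c → inj₂ (record
    { line = λ () ; focus = [] ; colour = λ () ; colour-injective = λ ()
    ; line-hasVar = λ () ; line-focused = λ () ; line-coloured = λ () })
  focusing (suc s) with focusing s
  ... | N , focusingₛ with hj (r ^ (suc k ^ N))
  ...   | M , hjₘ = M + N , step
    where
    -- Along the line λ₀ of the first M coordinates the colour of every suffix b is
    -- constant in the old letters, so c reduces to the induced colouring c′ of the suffix.
    step : (c : Vec (Fin (suc k)) (M + N) → Fin r) → MonochromaticLine c ⊎ Focused c (suc s)
    step c with uniformLine hjₘ (λ a b → c (Vec.map suc a ++ b))
    ... | λ₀ , var , uniform = extend (focusingₛ c′)
      where
      u = liftVarWord λ₀
      c′ : Vec (Fin (suc k)) N → Fin r
      c′ b = c (u [ suc x₀ ] ++ b)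
      u-coloured : ∀ x b → c (u [ suc x ] ++ b) ≡ c′ b
      u-coloured x b = begin
        c (u [ suc x ] ++ b)             ≡⟨ cong (λ v → c (v ++ b)) (liftVarWord-[] λ₀ x) ⟩
        c (Vec.map suc (λ₀ [ x ]) ++ b)  ≡⟨ uniform b x x₀ ⟩
        c (Vec.map suc (λ₀ [ x₀ ]) ++ b) ≡⟨ cong (λ v → c (v ++ b)) (liftVarWord-[] λ₀ x₀) ⟨
        c′ b                             ∎
        where open ≡-Reasoning
      extend : MonochromaticLine c′ ⊎ Focused c′ s → MonochromaticLine c ⊎ Focused c (suc s)
      extend (inj₁ mono) = inj₁ (monochromaticLine-prefix (u [ suc x₀ ]) c mono)
      extend (inj₂ F) with any? (λ i → c′ (focus F) ≟ colour F i)
      ... | yes (i , eq) = inj₁ (monochromaticLine-prefix (u [ suc x₀ ]) c (focused-monochromatic F i eq))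
      ... | no new = inj₂ (extendFocused c u (∈ᵥ-map⁺ (Maybe.map suc) var) c′ u-coloured F new)

  halesJewett-suc : HalesJewett (suc k) r
  halesJewett-suc with focusing (suc r)
  ... | N , focusingᵣ = N , λ c → [ id , ⊥-elim ∘ ¬focused ]′ (focusingᵣ c)

halesJewett : ∀ k r → HalesJewett k r
halesJewett zero r = 1 , λ c → nothing ∷ [] , VecAny.here refl , λ ()
halesJewett (suc zero) r = 1 , λ c → nothing ∷ [] , VecAny.here refl , λ { zero zero → refl }
halesJewett (suc (suc k)) r = ColourFocusing.halesJewett-suc (halesJewett (suc k)) zero

piecewiseSyndetic-colouring : ∀ {𝔸} {B : S₀ 𝔸 → Set} (ps : PiecewiseSyndetic 𝔸 B)
                              {I : Set} (is : List I) → (∀ i → i ∈ is) → (y : I → S₀ 𝔸) →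
                              Σ (S₀ 𝔸) λ x → Σ (I → Fin (length (proj₁ ps))) λ c →
                                ∀ i → B (List.lookup (proj₁ ps) (c i) ⁺++⁺ (y i ⁺++⁺ x))
piecewiseSyndetic-colouring {B = B} (G , syndetic) is complete y with syndetic (List.map y is)
... | x , cover = x , (λ i → proj₁ (indexed i)) , (λ i → proj₂ (indexed i))
  where
  indexed : ∀ i → Σ (Fin (length G)) λ j → B (List.lookup G j ⁺++⁺ (y i ⁺++⁺ x))
  indexed i with cover (∈-map⁺ y (complete i))
  ... | t , t∈G , Bt = Any.index t∈G , ≡.subst (λ t′ → B (t′ ⁺++⁺ (y i ⁺++⁺ x))) (lookup-index t∈G) Bt

module Sandwich (𝔸 : Alphabets) (n : ℕ) where
  open Alphabets 𝔸 using (Letter)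

  sandwich : S₀ 𝔸 → Word 𝔸 n → S₀ 𝔸 → Word 𝔸 n
  sandwich t v x = List⁺.map inj₁ t ⁺++⁺ (v ⁺++⁺ List⁺.map inj₁ x)

  sandwich-InS : ∀ t {v} x → InS 𝔸 n v → InS 𝔸 n (sandwich t v x)
  sandwich-InS t x var i = ∈ₗ-++⁺ʳ (toList (List⁺.map inj₁ t)) (∈ₗ-++⁺ˡ (var i))

  subst-inj₁ : (u : S₀ 𝔸) (a : Fin n → Letter) → subst 𝔸 (List⁺.map inj₁ u) a ≡ u
  subst-inj₁ u a = trans (sym (List⁺-map-∘ u)) (List⁺-map-id u)

  subst-sandwich : ∀ t v x (a : Fin n → Letter) → subst 𝔸 (sandwich t v x) a ≡ t ⁺++⁺ (subst 𝔸 v a ⁺++⁺ x)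
  subst-sandwich t v x a = begin
    List⁺.map g (List⁺.map inj₁ t ⁺++⁺ (v ⁺++⁺ List⁺.map inj₁ x))
      ≡⟨ map-⁺++⁺ g (List⁺.map inj₁ t) _ ⟩
    List⁺.map g (List⁺.map inj₁ t) ⁺++⁺ List⁺.map g (v ⁺++⁺ List⁺.map inj₁ x)
      ≡⟨ cong (List⁺.map g (List⁺.map inj₁ t) ⁺++⁺_) (map-⁺++⁺ g v (List⁺.map inj₁ x)) ⟩
    List⁺.map g (List⁺.map inj₁ t) ⁺++⁺ (List⁺.map g v ⁺++⁺ List⁺.map g (List⁺.map inj₁ x))
      ≡⟨ cong₂ (λ t′ x′ → t′ ⁺++⁺ (List⁺.map g v ⁺++⁺ x′)) (subst-inj₁ t a) (subst-inj₁ x a) ⟩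
    t ⁺++⁺ (subst 𝔸 v a ⁺++⁺ x)
      ∎
    where
    open ≡-Reasoning
    g : Letter ⊎ Fin n → Letter
    g = [ id , a ]

nonempty-∈ : ∀ {X : Set} (xs : List X) → xs ≢ List.[] → ∃ λ x → x ∈ xs
nonempty-∈ List.[] ne = contradiction refl ne
nonempty-∈ (x List.∷ _) _ = x , here refl

-- A tuple in Lⁿ is coded by a letter of Fin K and spelled as a block of n
-- letters; the variable is spelled as the block v₁ ⋯ vₙ.  The leading pad letter
-- keeps spelled words nonempty (N may be 0).
module Spelling (𝔸 : Alphabets) (n : ℕ) (L : List (Alphabets.Letter 𝔸))
                {pad : Alphabets.Letter 𝔸} (pad∈L : pad ∈ L) where
  open Alphabets 𝔸 using (Letter)
  open Sandwich 𝔸 n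

  K : ℕ
  K = length L ^ n

  spellTuple : Fin K → Fin n → Letter
  spellTuple b = List.lookup L ∘ finToFun b

  tupleCode : {a : Fin n → Letter} → (∀ i → a i ∈ L) → Fin K
  tupleCode a∈L = funToFin (Any.index ∘ a∈L)

  spellTuple-tupleCode : {a : Fin n → Letter} (a∈L : ∀ i → a i ∈ L) → ∀ i → a i ≡ spellTuple (tupleCode a∈L) i
  spellTuple-tupleCode a∈L i =
    trans (lookup-index (a∈L i)) (cong (List.lookup L) (sym (finToFun-funToFin (Any.index ∘ a∈L) i)))

  spellCell : Maybe (Fin K) → Fin n → Letter ⊎ Fin n
  spellCell (just b) = inj₁ ∘ spellTuple b
  spellCell nothing = inj₂

  spell : ∀ {N} → Vec (Fin K) N → S₀ 𝔸
  spell v = pad ∷ concatMap (List.tabulate ∘ spellTuple) (Vec.toList v)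

  spellVar : ∀ {N} → VarWord K N → Word 𝔸 n
  spellVar w = inj₁ pad ∷ concatMap (List.tabulate ∘ spellCell) (Vec.toList w)

  spellVar-InS : ∀ {N} {w : VarWord K N} → nothing ∈ᵥ w → InS 𝔸 n (spellVar w)
  spellVar-InS var i = there (∈-concat⁺′ (∈-tabulate⁺ i) (∈-map⁺ (List.tabulate ∘ spellCell) (∈-toList⁺ var)))

  subst-spellVar : ∀ {N} (w : VarWord K N) (a : Fin n → Letter) b →
                   (∀ i → a i ≡ spellTuple b i) → subst 𝔸 (spellVar w) a ≡ spell (w [ b ])
  subst-spellVar w a b a≡b = cong (pad ∷_) (begin
    List.map g (concatMap (List.tabulate ∘ spellCell) (Vec.toList w))
      ≡⟨ map-concatMap g (List.tabulate ∘ spellCell) (Vec.toList w) ⟩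
    concatMap (List.map g ∘ List.tabulate ∘ spellCell) (Vec.toList w)
      ≡⟨ concatMap-cong spelledCell (Vec.toList w) ⟩
    concatMap (List.tabulate ∘ spellTuple ∘ fromMaybe b) (Vec.toList w)
      ≡⟨ concatMap-map (List.tabulate ∘ spellTuple) (fromMaybe b) (Vec.toList w) ⟨
    concatMap (List.tabulate ∘ spellTuple) (List.map (fromMaybe b) (Vec.toList w))
      ≡⟨ cong (concatMap (List.tabulate ∘ spellTuple)) (toList-map (fromMaybe b) w) ⟨
    concatMap (List.tabulate ∘ spellTuple) (Vec.toList (w [ b ]))
      ∎)
    where
    open ≡-Reasoning
    g : Letter ⊎ Fin n → Letter
    g = [ id , a ]
    spelledLetter : ∀ e i → g (spellCell e i) ≡ spellTuple (fromMaybe b e) i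
    spelledLetter (just b′) i = refl
    spelledLetter nothing i = a≡b i
    spelledCell : ∀ e → List.map g (List.tabulate (spellCell e)) ≡ List.tabulate (spellTuple (fromMaybe b e))
    spelledCell e = trans (map-tabulate (spellCell e) g) (List-tabulate-cong (spelledLetter e))

  piecewiseSyndetic-variableWord : ∀ {D : S₀ 𝔸 → Set} → PiecewiseSyndetic 𝔸 D →
    Σ (Word 𝔸 n) λ w → InS 𝔸 n w × (∀ (a : Fin n → Letter) → (∀ i → a i ∈ L) → D (subst 𝔸 w a))
  piecewiseSyndetic-variableWord {D} ps with halesJewett K (length (proj₁ ps))
  ... | N , hj with piecewiseSyndetic-colouring {𝔸} {D} ps (allVecs K N) ∈-allVecs spell
  ...   | x , colour , coloured with hj colour
  ...     | line , var , mono = sandwich t (spellVar line) x , sandwich-InS t x (spellVar-InS var) , inD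
    where
    G = proj₁ ps
    b₀ : Fin K
    b₀ = tupleCode {λ _ → pad} (λ _ → pad∈L)
    t : S₀ 𝔸
    t = List.lookup G (colour (line [ b₀ ]))
    inD : ∀ a → (∀ i → a i ∈ L) → D (subst 𝔸 (sandwich t (spellVar line) x) a)
    inD a a∈L = ≡.subst D (sym (begin
      subst 𝔸 (sandwich t (spellVar line) x) a
        ≡⟨ subst-sandwich t (spellVar line) x a ⟩
      t ⁺++⁺ (subst 𝔸 (spellVar line) a ⁺++⁺ x)
        ≡⟨ cong₂ (λ t′ v → t′ ⁺++⁺ (v ⁺++⁺ x)) (cong (List.lookup G) (mono b₀ b))
                 (subst-spellVar line a b (spellTuple-tupleCode a∈L)) ⟩
      List.lookup G (colour (line [ b ])) ⁺++⁺ (spell (line [ b ]) ⁺++⁺ x)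
        ∎)) (coloured (line [ b ]))
      where
      open ≡-Reasoning
      b = tupleCode a∈L

mainTheorem1 : (𝔸 : Alphabets) (m n : ℕ) (D : S₀ 𝔸 → Set) →
    PiecewiseSyndetic 𝔸 D →
    Σ (Word 𝔸 n) λ w → InS 𝔸 n w ×
    (∀ (a : Fin n → Alphabets.Letter 𝔸) →
    (∀ i → a i ∈ Alphabets.layer 𝔸 m) → D (subst 𝔸 w a))
mainTheorem1 𝔸 m n D ps with nonempty-∈ (Alphabets.layer 𝔸 m) (Alphabets.nonempty 𝔸 m)
... | _ , pad∈layer = Spelling.piecewiseSyndetic-variableWord 𝔸 n (Alphabets.layer 𝔸 m) pad∈layer {D} ps
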